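{- Let $\mathbf{LP}$ be the suboperad of $\mathbb{K}\mathbf{MG}$ generated by the multigraph on $\{a\}$ consisting of one loop at $a$ and the edgeless multigraph on $\{a,b\}$, and let $\mathbf{SP}$ be the suboperad of $\mathbb{K}\mathbf{G}\subseteq\mathbb{K}\mathbf{MG}$ generated by the edgeless graph and the one-edge graph on $\{a,b\}$. Then (i) $\mathbf{SP}$ is a suboperad of $\mathbf{LP}$; (ii) $\mathbf{LP}$ is a strict suboperad of $\mathbb{K}\mathbf{MG}$; in particular the multigraph on $\{a,b,c\}$ with edge multiset $\{\{a,b\},\{b,c\},\{b,c\}\}$ belongs to $\mathbb{K}\mathbf{MG}$ but not to $\mathbf{LP}$.
   Context: Field $\mathbb{K}$ of characteristic zero; operads in the species formalism (spaces indexed by nonempty finite sets, functorial in bijections, units in arity one, equivariant partial compositions $\circ_\ast$ for disjoint $V_1\ni\ast$, $V_2$ landing in arity $(V_1\setminus\{\ast\})\sqcup V_2$). A multigraph on $V$ is a finite multiset of unordered pairs $\{u,v\}$, $u,v\in V$ (loops $u=v$ allowed); $\mathbb{K}\mathbf{MG}[V]$ has basis the multigraphs on $V$. Insertion: for $g_1$ on $V_1\ni\ast$ and $g_2$ on $V_2$, each end at $\ast$ of an edge of $g_1$ is a loose end (a loop at $\ast$ gives two, all loose ends distinguished); $g_1\circ_\ast g_2=\sum_f g_f$ over all maps $f$ from the set of loose ends to $V_2$, where $g_f$ consists of the edges of $g_1$ not containing $\ast$, the edges of $g_2$, and each edge of $g_1$ containing $\ast$ with each occurrence of $\ast$ replaced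 by $f$ of the corresponding loose end. This makes $\mathbb{K}\mathbf{MG}$ an operad, and the span $\mathbb{K}\mathbf{G}$ of simple graphs (no loops, no repeated edges) is a suboperad. The suboperad generated by a set of elements is the smallest suboperad containing them (closed under relabellings, linear combinations and partial compositions). "Belongs to $\mathbf{LP}$" means the basis element lies in the subspace $\mathbf{LP}[\{a,b,c\}]$. -}

module Defs where

open import Level using (Level; _⊔_)
open import Data.Nat as ℕ using (ℕ; zero; suc)
open import Data.Fin as Fin using (Fin; zero; suc; _↑ˡ_; _↑ʳ_)
open import Data.Fin.Properties using (all?) renaming (_≟_ to _≟F_)
open import Data.Fin.Permutation using (Permutation′; _⟨$⟩ʳ_)
open import Data.List using (List; []; _∷_; _++_; map; concatMap; filter; length; foldr; allFin)
open import Data.Product using (_×_; _,_; Σ)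
open import Data.Product.Relation.Binary.Pointwise.NonDependent using ()
open import Data.Bool using (if_then_else_)
open import Relation.Nullary using (¬_; Dec; does)
open import Relation.Nullary.Decidable using (_×-dec_; _⊎-dec_)
open import Relation.Binary.PropositionalEquality using (_≡_)
open import Algebra.Bundles using (CommutativeRing)

natToK : ∀ {c ℓ} (R : CommutativeRing c ℓ) → ℕ → CommutativeRing.Carrier R
natToK R zero    = CommutativeRing.0# R
natToK R (suc n) = CommutativeRing._+_ R (CommutativeRing.1# R) (natToK R n)

record CharZeroField (c ℓ : Level) : Set (Level.suc (c ⊔ ℓ)) where
  field
    commutativeRing : CommutativeRing c ℓ
  open CommutativeRing commutativeRing
  field
    1≉0      : ¬ (1# ≈ 0#)
    inverse  : ∀ x → ¬ (x ≈ 0#) → Σ Carrier (λ y → (x * y) ≈ 1#)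
    charZero : ∀ n → natToK commutativeRing n ≈ 0# → n ≡ 0
  open CommutativeRing commutativeRing public

-- A multigraph is a list of edges; an edge (x , y) stands for the
-- unordered pair {x , y} (x ≡ y is a loop).  Two lists describe the
-- same multigraph iff every unordered pair occurs equally often.

Edge : ℕ → Set
Edge n = Fin n × Fin n

MG : ℕ → Set
MG n = List (Edge n)

count : ∀ {n} → Fin n → Fin n → MG n → ℕ
count u v g =
  length (filter (λ { (x , y) → ((x ≟F u) ×-dec (y ≟F v)) ⊎-dec ((x ≟F v) ×-dec (y ≟F u)) }) g)

_≅MG_ : ∀ {n} → MG n → MG n → Set
g ≅MG h = ∀ u v → count u v g ≡ count u v h

_≅MG?_ : ∀ {n} (g h : MG n) → Dec (g ≅MG h)
g ≅MG? h = all? (λ u → all? (λ v → count u v g ℕ.≟ count u v h))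

relabelMG : ∀ {m n} → (Fin m → Fin n) → MG m → MG n
relabelMG f = map (λ { (x , y) → (f x , f y) })

-- Insertion of g₂ (on Fin k) into g₁ (on Fin (suc m)) at the vertex
-- * = zero.  Vertices of the result Fin (m + k): the vertex suc j of g₁
-- becomes j ↑ˡ k, the vertex u of g₂ becomes m ↑ʳ u.
-- The result is the list of the g_f, one for each map f from loose ends
-- to the vertices of g₂ (so it is a sum with all coefficients 1).
module _ {m k : ℕ} where
  endChoices : Fin (suc m) → List (Fin (m ℕ.+ k))
  endChoices zero    = map (m ↑ʳ_) (allFin k)
  endChoices (suc j) = (j ↑ˡ k) ∷ []

  edgeChoices : Edge (suc m) → List (Edge (m ℕ.+ k))
  edgeChoices (x , y) = concatMap (λ a → map (λ b → (a , b)) (endChoices y)) (endChoices x)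

  allChoices : MG (suc m) → List (MG (m ℕ.+ k))
  allChoices []       = [] ∷ []
  allChoices (e ∷ es) = concatMap (λ e′ → map (e′ ∷_) (allChoices es)) (edgeChoices e)

  insertMG : MG (suc m) → MG k → List (MG (m ℕ.+ k))
  insertMG g₁ g₂ = map (λ es → es ++ relabelMG (m ↑ʳ_) g₂) (allChoices g₁)

module Operad {c ℓ} (K : CharZeroField c ℓ) where
  open CharZeroField K using (Carrier; _≈_; _+_; _*_; 0#; 1#)

  -- elements of KMG[Fin n]: formal linear combinations of multigraphs
  FS : ℕ → Set c
  FS n = List (Carrier × MG n)

  coeff : ∀ {n} → FS n → MG n → Carrier
  coeff xs g = foldr (λ { (a , h) acc → if does (h ≅MG? g) then a + acc else acc }) 0# xs

  _≈FS_ : ∀ {n} → FS n → FS n → Set ℓ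
  xs ≈FS ys = ∀ g → coeff xs g ≈ coeff ys g

  basis : ∀ {n} → MG n → FS n
  basis g = (1# , g) ∷ []

  scaleFS : ∀ {n} → Carrier → FS n → FS n
  scaleFS a = map (λ { (b , g) → (a * b , g) })

  relabelFS : ∀ {n} → Permutation′ n → FS n → FS n
  relabelFS σ = map (λ { (a , g) → (a , relabelMG (σ ⟨$⟩ʳ_) g) })

  compFS : ∀ {m k} → FS (suc m) → FS k → FS (m ℕ.+ k)
  compFS {m} {k} xs ys =
    concatMap (λ { (a , g) → concatMap (λ { (b , h) →
      map (λ r → (a * b , r)) (insertMG {m} {k} g h) }) ys }) xs

  unitFS : FS 1
  unitFS = basis []

  data Generated (Gens : ∀ {n} → FS n → Set c) : ∀ {n} → FS n → Set (c ⊔ ℓ) where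
    gen     : ∀ {n} {x : FS n} → Gens x → Generated Gens x
    unit    : Generated Gens unitFS
    zeroEl  : ∀ {n} → Generated Gens {n} []
    add     : ∀ {n} {x y : FS n} → Generated Gens x → Generated Gens y → Generated Gens (x ++ y)
    scale   : ∀ {n} (a : Carrier) {x : FS n} → Generated Gens x → Generated Gens (scaleFS a x)
    relabel : ∀ {n} (σ : Permutation′ n) {x : FS n} → Generated Gens x → Generated Gens (relabelFS σ x)
    comp    : ∀ {m k} {x : FS (suc m)} {y : FS (suc k)} →
              Generated Gens x → Generated Gens y → Generated Gens (compFS x y)
    resp    : ∀ {n} {x y : FS n} → x ≈FS y → Generated Gens x → Generated Gens y

  data LPGens : ∀ {n} → FS n → Set c where
    loop     : LPGens {1} (basis ((zero , zero) ∷ []))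
    edgeless : LPGens {2} (basis [])

  data SPGens : ∀ {n} → FS n → Set c where
    edgeless : SPGens {2} (basis [])
    edge     : SPGens {2} (basis ((zero , suc zero) ∷ []))

  LP : ∀ {n} → FS n → Set (c ⊔ ℓ)
  LP = Generated LPGens

  SP : ∀ {n} → FS n → Set (c ⊔ ℓ)
  SP = Generated SPGens

  gABBCBC : MG 3
  gABBCBC = (zero , suc zero) ∷ (suc zero , suc (suc zero)) ∷ (suc zero , suc (suc zero)) ∷ []

-- (i) Inserting the edgeless graph on {a,b} into the loop gives the four graphs {aa}, {ab}, {ba}
-- and {bb}; the two loops also arise by inserting the loop into the edgeless graph (and swapping
-- a and b), so twice the edge {a,b}, and hence the edge itself, lies in LP.
--
-- (ii) Write path x y z for the multigraph {xy, yz, yz} on {a,b,c}, and let φ be the linear form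
-- on KMG[{a,b,c}] that is sgn(x y z) on the isomorphism class of path x y z and 0 on every other
-- multigraph. A transposition of the vertices changes the sign of φ, so ker φ is closed under
-- relabelling. Since the generators of LP have arities one and two, by induction it remains to see
-- that φ kills every partial composition x ∘ y of arities 1∘3, 2∘2 or 3∘1 whose factor of arity
-- three lies in ker φ. In 1∘3 either x is edgeless and x ∘ y = y, or the ends of a loop of x run
-- over all nine ordered pairs of vertices, whose contributions to φ cancel; in 3∘1 either y is
-- edgeless and x ∘ y is a relabelling of x, or x ∘ y has a loop; the insertions 2∘2 cancel as
-- well. Both cancellations are exhaustive finite checks. Hence φ vanishes on LP, whereas
-- gABBCBC = path a b c.

module Submission where

open import Defs
open import Level using (Level)
open import Data.Nat using (ℕ)
open import Data.Product using (_×_)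
open import Relation.Nullary using (¬_)

open import Data.Nat as ℕ using (zero; suc)
import Data.Nat.Properties as ℕ
open import Data.Nat.ListAction using (sum)
open import Data.Fin using (Fin; _↑ʳ_)
open import Data.Fin.Patterns using (0F; 1F; 2F)
open import Data.Fin.Properties using (all?) renaming (_≟_ to _≟F_)
open import Data.Fin.Permutation
  using (Permutation′; _⟨$⟩ʳ_; _⟨$⟩ˡ_; _∘ₚ_; id; flip; transpose; inverseˡ; inverseʳ)
open import Data.Fin.Permutation.Transposition.List
  using (TranspositionList; eval; decompose; eval-decompose)
open import Data.Bool using (Bool; true; false; if_then_else_)
open import Data.List using (List; []; _∷_; _++_; length; filter; map; concatMap)
open import Data.List.Properties
  using ( map-∘; map-cong; map-id; length-++; length-map; ++-identityʳ
        ; filter-++; filter-≐; filter-none; filter-accept; filter-reject )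
open import Data.List.Relation.Unary.All as All using (All; []; _∷_)
open import Data.List.Relation.Unary.All.Properties using (¬Any⇒All¬; ++⁻; concat⁺; map⁺)
open import Data.List.Relation.Unary.Any as Any using ()
open import Data.Product using (_,_; proj₁; proj₂)
import Data.Product as Prod
open import Data.Sum as Sum using (_⊎_)
open import Data.Empty using (⊥-elim)
open import Function using (_∘_; _⇔_; mk⇔; Equivalence)
open import Relation.Nullary using (Dec; yes; no; does)
open import Relation.Nullary.Decidable using (_×-dec_; _⊎-dec_; map′; does-⇔; toWitness)
open import Relation.Unary using (Decidable)
open import Relation.Binary.PropositionalEquality
  using (_≡_; _≢_; refl; sym; trans; cong; cong₂; subst; module ≡-Reasoning)
open import Algebra.Bundles using (CommutativeRing)
open import Algebra.Properties.CommutativeSemigroup ℕ.+-commutativeSemigroup using (interchange)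

private
  variable
    n : ℕ

count-++ : ∀ (u v : Fin n) g h → count u v (g ++ h) ≡ count u v g ℕ.+ count u v h
count-++ u v g h = trans (cong length (filter-++ _ g h)) (length-++ (filter _ g))

matches : Edge n → Edge n → Bool
matches (x , y) (u , v) = does (((x ≟F u) ×-dec (y ≟F v)) ⊎-dec ((x ≟F v) ×-dec (y ≟F u)))

count-single : ∀ (u v : Fin n) e → count u v (e ∷ []) ≡ (if matches e (u , v) then 1 else 0)
count-single u v (x , y) with matches (x , y) (u , v)
... | true  = refl
... | false = refl

count-relabel : ∀ {m} {f : Fin m → Fin n} → (∀ {x y} → f x ≡ f y → x ≡ y) →
                ∀ u v g → count (f u) (f v) (relabelMG f g) ≡ count u v g
count-relabel f-inj u v []                    = refl
count-relabel {f = f} f-inj u v ((x , y) ∷ g) = begin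
  count (f u) (f v) ((f x , f y) ∷ relabelMG f g)
    ≡⟨ count-++ (f u) (f v) ((f x , f y) ∷ []) (relabelMG f g) ⟩
  count (f u) (f v) ((f x , f y) ∷ []) ℕ.+ count (f u) (f v) (relabelMG f g)
    ≡⟨ cong₂ ℕ._+_ single (count-relabel f-inj u v g) ⟩
  count u v ((x , y) ∷ []) ℕ.+ count u v g
    ≡⟨ count-++ u v ((x , y) ∷ []) g ⟨
  count u v ((x , y) ∷ g) ∎
  where
  open ≡-Reasoning
  ≟-inj : ∀ a b → does (f a ≟F f b) ≡ does (a ≟F b)
  ≟-inj a b = does-⇔ (mk⇔ f-inj (cong f)) (f a ≟F f b) (a ≟F b)
  same-match : matches (f x , f y) (f u , f v) ≡ matches (x , y) (u , v)
  same-match rewrite ≟-inj x u | ≟-inj y v | ≟-inj x v | ≟-inj y u = refl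
  single : count (f u) (f v) ((f x , f y) ∷ []) ≡ count u v ((x , y) ∷ [])
  single = trans (count-single (f u) (f v) (f x , f y))
                 (trans (cong (if_then 1 else 0) same-match) (sym (count-single u v (x , y))))

≅-sym : ∀ {g h : MG n} → g ≅MG h → h ≅MG g
≅-sym g≅h u v = sym (g≅h u v)

≅-trans : ∀ {g h r : MG n} → g ≅MG h → h ≅MG r → g ≅MG r
≅-trans g≅h h≅r u v = trans (g≅h u v) (h≅r u v)

≅MG?-congˡ : ∀ {g g′ : MG n} → g ≅MG g′ → ∀ h → does (g ≅MG? h) ≡ does (g′ ≅MG? h)
≅MG?-congˡ {g = g} {g′} g≅g′ h = does-⇔ (mk⇔ g≅h→g′≅h g′≅h→g≅h) (g ≅MG? h) (g′ ≅MG? h)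
  where
  g≅h→g′≅h : g ≅MG h → g′ ≅MG h
  g≅h→g′≅h = ≅-trans {g = g′} {g} {h} (≅-sym {g = g} {g′} g≅g′)
  g′≅h→g≅h : g′ ≅MG h → g ≅MG h
  g′≅h→g≅h = ≅-trans {g = g} {g′} {h} g≅g′

count-relabel⁻¹ : ∀ (σ : Permutation′ n) u v g →
                  count u v (relabelMG (σ ⟨$⟩ʳ_) g) ≡ count (σ ⟨$⟩ˡ u) (σ ⟨$⟩ˡ v) g
count-relabel⁻¹ σ u v g = begin
  count u v (relabelMG (σ ⟨$⟩ʳ_) g)
    ≡⟨ cong₂ (λ u′ v′ → count u′ v′ (relabelMG (σ ⟨$⟩ʳ_) g)) (inverseʳ σ) (inverseʳ σ) ⟨
  count (σ ⟨$⟩ʳ (σ ⟨$⟩ˡ u)) (σ ⟨$⟩ʳ (σ ⟨$⟩ˡ v)) (relabelMG (σ ⟨$⟩ʳ_) g)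
    ≡⟨ count-relabel σ-injective _ _ g ⟩
  count (σ ⟨$⟩ˡ u) (σ ⟨$⟩ˡ v) g ∎
  where
  open ≡-Reasoning
  σ-injective : ∀ {x y} → σ ⟨$⟩ʳ x ≡ σ ⟨$⟩ʳ y → x ≡ y
  σ-injective σx≡σy = trans (sym (inverseˡ σ)) (trans (cong (σ ⟨$⟩ˡ_) σx≡σy) (inverseˡ σ))

≅-relabel : ∀ (σ : Permutation′ n) {g h} → g ≅MG h → relabelMG (σ ⟨$⟩ʳ_) g ≅MG relabelMG (σ ⟨$⟩ʳ_) h
≅-relabel σ {g} {h} g≅h u v =
  trans (count-relabel⁻¹ σ u v g) (trans (g≅h _ _) (sym (count-relabel⁻¹ σ u v h)))

relabel-inverseˡ : ∀ (σ : Permutation′ n) g → relabelMG (σ ⟨$⟩ˡ_) (relabelMG (σ ⟨$⟩ʳ_) g) ≡ g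
relabel-inverseˡ σ g = begin
  relabelMG (σ ⟨$⟩ˡ_) (relabelMG (σ ⟨$⟩ʳ_) g) ≡⟨ map-∘ g ⟨
  map _ g                                    ≡⟨ map-cong (λ _ → cong₂ _,_ (inverseˡ σ) (inverseˡ σ)) g ⟩
  map (λ e → e) g                            ≡⟨ map-id g ⟩
  g                                          ∎
  where open ≡-Reasoning

sum-map-+ : ∀ {a} {A : Set a} (f f′ : A → ℕ) xs →
            sum (map (λ x → f x ℕ.+ f′ x) xs) ≡ sum (map f xs) ℕ.+ sum (map f′ xs)
sum-map-+ f f′ []       = refl
sum-map-+ f f′ (x ∷ xs) =
  trans (cong (f x ℕ.+ f′ x ℕ.+_) (sum-map-+ f f′ xs)) (interchange (f x) (f′ x) _ _)

pairs₃ : List (Edge 3)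
pairs₃ = (0F , 0F) ∷ (0F , 1F) ∷ (0F , 2F) ∷ (1F , 1F) ∷ (1F , 2F) ∷ (2F , 2F) ∷ []

totalCount : MG 3 → ℕ
totalCount g = sum (map (λ (u , v) → count u v g) pairs₃)

totalCount-edge : ∀ (e : Edge 3) → totalCount (e ∷ []) ≡ 1
totalCount-edge (x , y) = toWitness {a? = all? λ x → all? λ y → totalCount ((x , y) ∷ []) ℕ.≟ 1} _ x y

length≡totalCount : ∀ g → length g ≡ totalCount g
length≡totalCount []      = refl
length≡totalCount (e ∷ g) = begin
  suc (length g)
    ≡⟨ cong₂ ℕ._+_ (totalCount-edge e) (sym (length≡totalCount g)) ⟨
  totalCount (e ∷ []) ℕ.+ totalCount g
    ≡⟨ sum-map-+ (λ (u , v) → count u v (e ∷ [])) (λ (u , v) → count u v g) pairs₃ ⟨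
  sum (map (λ (u , v) → count u v (e ∷ []) ℕ.+ count u v g) pairs₃)
    ≡⟨ cong sum (map-cong (λ (u , v) → sym (count-++ u v (e ∷ []) g)) pairs₃) ⟩
  totalCount (e ∷ g) ∎
  where open ≡-Reasoning

≅-length : ∀ {g h : MG 3} → g ≅MG h → length g ≡ length h
≅-length {g} {h} g≅h = begin
  length g     ≡⟨ length≡totalCount g ⟩
  totalCount g ≡⟨ cong sum (map-cong (λ (u , v) → g≅h u v) pairs₃) ⟩
  totalCount h ≡⟨ length≡totalCount h ⟨
  length h     ∎
  where open ≡-Reasoning

#≅ : MG n → List (MG n) → ℕ
#≅ g L = length (filter (g ≅MG?_) L)

#≅-cong : ∀ {g h : MG n} → g ≅MG h → ∀ L → #≅ g L ≡ #≅ h L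
#≅-cong {g = g} {h} g≅h L =
  cong length (filter-≐ (g ≅MG?_) (h ≅MG?_) ((λ {r} → g≅⊆h≅ {r}) , (λ {r} → h≅⊆g≅ {r})) L)
  where
  g≅⊆h≅ : ∀ {r} → g ≅MG r → h ≅MG r
  g≅⊆h≅ {r} = ≅-trans {g = h} {g} {r} (≅-sym {g = g} {h} g≅h)
  h≅⊆g≅ : ∀ {r} → h ≅MG r → g ≅MG r
  h≅⊆g≅ {r} = ≅-trans {g = g} {h} {r} g≅h

#≅-absent : ∀ {g : MG n} {L} → All (λ r → ¬ g ≅MG r) L → #≅ g L ≡ 0
#≅-absent g≇L = cong length (filter-none _ g≇L)

#≅-map : ∀ {g h : MG n} (ρ : MG n → MG n) → (∀ {r} → h ≅MG ρ r ⇔ g ≅MG r) →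
         ∀ L → #≅ h (map ρ L) ≡ #≅ g L
#≅-map ρ ρ-match [] = refl
#≅-map {g = g} {h} ρ ρ-match (r ∷ L) with g ≅MG? r
... | yes g≅r = begin
  #≅ h (ρ r ∷ map ρ L)
    ≡⟨ cong length (filter-accept (h ≅MG?_) {ρ r} {map ρ L} (Equivalence.from ρ-match g≅r)) ⟩
  suc (#≅ h (map ρ L)) ≡⟨ cong suc (#≅-map {g = g} {h} ρ ρ-match L) ⟩
  suc (#≅ g L)         ≡⟨ cong length (filter-accept (g ≅MG?_) {r} {L} g≅r) ⟨
  #≅ g (r ∷ L)         ∎
  where open ≡-Reasoning
... | no g≇r = begin
  #≅ h (ρ r ∷ map ρ L)
    ≡⟨ cong length (filter-reject (h ≅MG?_) {ρ r} {map ρ L} (g≇r ∘ Equivalence.to ρ-match)) ⟩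
  #≅ h (map ρ L)       ≡⟨ #≅-map {g = g} {h} ρ ρ-match L ⟩
  #≅ g L               ≡⟨ cong length (filter-reject (g ≅MG?_) {r} {L} g≇r) ⟨
  #≅ g (r ∷ L)         ∎
  where open ≡-Reasoning

#≅-relabel : ∀ (σ : Permutation′ n) g L →
             #≅ (relabelMG (σ ⟨$⟩ʳ_) g) L ≡ #≅ g (map (relabelMG (σ ⟨$⟩ˡ_)) L)
#≅-relabel σ g L = sym (#≅-map {g = σg} {g} σ⁻¹ (λ {r} → mk⇔ (to {r}) (from {r})) L)
  where
  σg : MG _
  σg = relabelMG (σ ⟨$⟩ʳ_) g
  σ⁻¹ : MG _ → MG _
  σ⁻¹ = relabelMG (σ ⟨$⟩ˡ_)
  to : ∀ {r} → g ≅MG σ⁻¹ r → σg ≅MG r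
  to {r} g≅σ⁻¹r = subst (σg ≅MG_) (relabel-inverseˡ (flip σ) r) (≅-relabel σ {g} {σ⁻¹ r} g≅σ⁻¹r)
  from : ∀ {r} → σg ≅MG r → g ≅MG σ⁻¹ r
  from {r} σg≅r = subst (_≅MG σ⁻¹ r) (relabel-inverseˡ σ g) (≅-relabel (flip σ) {σg} {r} σg≅r)

_≋_ : List (MG n) → List (MG n) → Set
L₁ ≋ L₂ = ∀ g → #≅ g L₁ ≡ #≅ g L₂

SameClasses : List (MG n) → List (MG n) → Set
SameClasses L₁ L₂ = All (λ r → #≅ r L₁ ≡ #≅ r L₂) (L₁ ++ L₂)

sameClasses? : (L₁ L₂ : List (MG n)) → Dec (SameClasses L₁ L₂)
sameClasses? L₁ L₂ = All.all? (λ r → #≅ r L₁ ℕ.≟ #≅ r L₂) (L₁ ++ L₂)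

sameClasses⇒≋ : ∀ (L₁ L₂ : List (MG n)) → SameClasses L₁ L₂ → L₁ ≋ L₂
sameClasses⇒≋ L₁ L₂ same g with Any.any? (g ≅MG?_) (L₁ ++ L₂)
... | yes g≅some = let same-r , g≅r = All.lookupAny same g≅some in
  trans (#≅-cong {g = g} {Any.lookup g≅some} g≅r L₁)
        (trans same-r (sym (#≅-cong {g = g} {Any.lookup g≅some} g≅r L₂)))
... | no g≅none = let g∉L₁ , g∉L₂ = ++⁻ L₁ (¬Any⇒All¬ (L₁ ++ L₂) g≅none) in
  trans (#≅-absent {g = g} g∉L₁) (sym (#≅-absent {g = g} g∉L₂))

-- Paths on three vertices and their parity

path : Fin 3 → Fin 3 → Fin 3 → MG 3
path x y z = (x , y) ∷ (y , z) ∷ (y , z) ∷ []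

evenPaths oddPaths : List (MG 3)
evenPaths = path 0F 1F 2F ∷ path 1F 2F 0F ∷ path 2F 0F 1F ∷ []
oddPaths  = path 1F 0F 2F ∷ path 0F 2F 1F ∷ path 2F 1F 0F ∷ []

evenPathsOf oddPathsOf : ∀ n → List (MG n)
evenPathsOf 3 = evenPaths
evenPathsOf _ = []
oddPathsOf 3  = oddPaths
oddPathsOf _  = []

PreservesParity SwapsParity : (Fin 3 → Fin 3) → Set
PreservesParity f = map (relabelMG f) evenPaths ≋ evenPaths × map (relabelMG f) oddPaths ≋ oddPaths
SwapsParity     f = map (relabelMG f) evenPaths ≋ oddPaths  × map (relabelMG f) oddPaths ≋ evenPaths

Balanced : List (MG 3) → Set
Balanced L = sum (map (λ r → #≅ r evenPaths) L) ≡ sum (map (λ r → #≅ r oddPaths) L)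

∀-ofLength? : ∀ {p} {P : MG n → Set p} → Decidable P → ∀ k → Dec (∀ g → length g ≡ k → P g)
∀-ofLength? P? zero = map′ (λ { P[] [] refl → P[] }) (λ ∀P → ∀P [] refl) (P? [])
∀-ofLength? {P = P} P? (suc k) =
  map′ cons uncons (all? λ x → all? λ y → ∀-ofLength? (P? ∘ ((x , y) ∷_)) k)
  where
  cons : (∀ x y g → length g ≡ k → P ((x , y) ∷ g)) → ∀ g → length g ≡ suc k → P g
  cons ∀P ((x , y) ∷ g) len = ∀P x y g (ℕ.suc-injective len)
  uncons : (∀ g → length g ≡ suc k → P g) → ∀ x y g → length g ≡ k → P ((x , y) ∷ g)
  uncons ∀P x y g len = ∀P ((x , y) ∷ g) (cong suc len)

-- Finite checks decided by evaluation, opaque so that conversion checking never unfolds them.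
opaque
  transpose-parity : ∀ (i j : Fin 3) →
                     PreservesParity (transpose i j ⟨$⟩ˡ_) ⊎ SwapsParity (transpose i j ⟨$⟩ˡ_)
  transpose-parity i j =
    Sum.map (Prod.map (sameClasses⇒≋ (τ evenPaths) evenPaths) (sameClasses⇒≋ (τ oddPaths) oddPaths))
            (Prod.map (sameClasses⇒≋ (τ evenPaths) oddPaths) (sameClasses⇒≋ (τ oddPaths) evenPaths))
            (toWitness {a? = all? λ i → all? λ j → parity? (map (relabelMG (transpose i j ⟨$⟩ˡ_)))} _ i j)
    where
    τ : List (MG 3) → List (MG 3)
    τ = map (relabelMG (transpose i j ⟨$⟩ˡ_))
    parity? : ∀ (act : List (MG 3) → List (MG 3)) →
              Dec ((SameClasses (act evenPaths) evenPaths × SameClasses (act oddPaths) oddPaths) ⊎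
                   (SameClasses (act evenPaths) oddPaths × SameClasses (act oddPaths) evenPaths))
    parity? act = (sameClasses? (act evenPaths) evenPaths ×-dec sameClasses? (act oddPaths) oddPaths) ⊎-dec
                  (sameClasses? (act evenPaths) oddPaths ×-dec sameClasses? (act oddPaths) evenPaths)

  2∘2-balanced : ∀ i j → i ℕ.+ j ≡ 3 → ∀ (g : MG 2) → length g ≡ i → ∀ h → length h ≡ j →
                 Balanced (insertMG {1} {2} g h)
  2∘2-balanced 0 .3 refl = toWitness {a? = ∀-ofLength? (λ g → ∀-ofLength? (λ h → _ ℕ.≟ _) 3) 0} _
  2∘2-balanced 1 .2 refl = toWitness {a? = ∀-ofLength? (λ g → ∀-ofLength? (λ h → _ ℕ.≟ _) 2) 1} _
  2∘2-balanced 2 .1 refl = toWitness {a? = ∀-ofLength? (λ g → ∀-ofLength? (λ h → _ ℕ.≟ _) 1) 2} _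
  2∘2-balanced 3 .0 refl = toWitness {a? = ∀-ofLength? (λ g → ∀-ofLength? (λ h → _ ℕ.≟ _) 0) 3} _

  loop-balanced : ∀ (L : MG 3) → length L ≡ 2 → Balanced (map (_∷ L) (edgeChoices {0} {3} (0F , 0F)))
  loop-balanced = toWitness {a? = ∀-ofLength? (λ L → _ ℕ.≟ _) 2} _

allChoices-length : ∀ {m k} (g : MG (suc m)) → All (λ r → length r ≡ length g) (allChoices {m} {k} g)
allChoices-length []       = refl ∷ []
allChoices-length (e ∷ es) =
  concat⁺ (map⁺ (All.universal (λ _ → map⁺ (All.map (cong suc) (allChoices-length es))) (edgeChoices e)))

insertMG-length : ∀ {m k} (g : MG (suc m)) (h : MG k) →
                  All (λ r → length r ≡ length g ℕ.+ length h) (insertMG g h)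
insertMG-length g h = map⁺ (All.map (λ {es} len → trans (length-++ es) (cong₂ ℕ._+_ len (length-map _ h)))
                                    (allChoices-length g))

-- Inserting a one-vertex graph at the vertex 0 of a graph on Fin 3 relabels it by 0 ↦ 2, 1 ↦ 0, 2 ↦ 1.
rotation : Permutation′ 3
rotation = eval ((0F , 1F) ∷ (1F , 2F) ∷ [])

endChoices-rotation : ∀ x → endChoices {2} {1} x ≡ (rotation ⟨$⟩ʳ x) ∷ []
endChoices-rotation 0F = refl
endChoices-rotation 1F = refl
endChoices-rotation 2F = refl

allChoices-rotation : ∀ g → allChoices {2} {1} g ≡ relabelMG (rotation ⟨$⟩ʳ_) g ∷ []
allChoices-rotation []            = refl
allChoices-rotation ((x , y) ∷ g)
  rewrite endChoices-rotation x | endChoices-rotation y | allChoices-rotation g = refl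

data CompArity : ℕ → ℕ → Set where
  1∘3   : CompArity 0 2
  2∘2   : CompArity 1 1
  3∘1   : CompArity 2 0
  other : ∀ {m k} → m ℕ.+ suc k ≢ 3 → CompArity m k

compArity : ∀ m k → CompArity m k
compArity 0 0                   = other λ ()
compArity 0 1                   = other λ ()
compArity 0 2                   = 1∘3
compArity 0 (suc (suc (suc k))) = other λ ()
compArity 1 0                   = other λ ()
compArity 1 1                   = 2∘2
compArity 1 (suc (suc k))       = other λ ()
compArity 2 0                   = 3∘1
compArity 2 (suc k)             = other λ ()
compArity (suc (suc (suc m))) k = other λ 3+m+1+k≡3 →
  ℕ.1+n≢0 (trans (sym (ℕ.+-suc m k)) (ℕ.suc-injective (ℕ.suc-injective (ℕ.suc-injective 3+m+1+k≡3))))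

module ListSums {c ℓ} (R : CommutativeRing c ℓ) where
  open CommutativeRing R renaming (refl to ≈-refl; sym to ≈-sym; trans to ≈-trans; reflexive to ≈-reflexive)
  open import Algebra.Properties.CommutativeSemigroup +-commutativeSemigroup
    using () renaming (interchange to +-interchange)
  open import Algebra.Properties.AbelianGroup +-abelianGroup using (⁻¹-∙-comm; ε⁻¹≈ε)

  private
    variable
      a : Level
      A B : Set a

  ∑ : (A → Carrier) → List A → Carrier
  ∑ f []       = 0#
  ∑ f (x ∷ xs) = f x + ∑ f xs

  ∑-cong : ∀ {f f′ : A → Carrier} → (∀ x → f x ≈ f′ x) → ∀ xs → ∑ f xs ≈ ∑ f′ xs
  ∑-cong f≈f′ []       = ≈-refl
  ∑-cong f≈f′ (x ∷ xs) = +-cong (f≈f′ x) (∑-cong f≈f′ xs)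

  ∑-vanish : ∀ {f : A → Carrier} {xs} → All (λ x → f x ≈ 0#) xs → ∑ f xs ≈ 0#
  ∑-vanish []            = ≈-refl
  ∑-vanish (fx≈0 ∷ f≈0) = ≈-trans (+-cong fx≈0 (∑-vanish f≈0)) (+-identityʳ 0#)

  ∑-++ : ∀ (f : A → Carrier) xs ys → ∑ f (xs ++ ys) ≈ ∑ f xs + ∑ f ys
  ∑-++ f []       ys = ≈-sym (+-identityˡ _)
  ∑-++ f (x ∷ xs) ys = ≈-trans (+-congˡ (∑-++ f xs ys)) (≈-sym (+-assoc _ _ _))

  ∑-map : ∀ (f : B → Carrier) (g : A → B) xs → ∑ f (map g xs) ≡ ∑ (λ x → f (g x)) xs
  ∑-map f g []       = refl
  ∑-map f g (x ∷ xs) = cong (f (g x) +_) (∑-map f g xs)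

  ∑-concatMap : ∀ (f : B → Carrier) (g : A → List B) xs → ∑ f (concatMap g xs) ≈ ∑ (λ x → ∑ f (g x)) xs
  ∑-concatMap f g []       = ≈-refl
  ∑-concatMap f g (x ∷ xs) = ≈-trans (∑-++ f (g x) _) (+-congˡ (∑-concatMap f g xs))

  ∑-+ : ∀ (f f′ : A → Carrier) xs → ∑ (λ x → f x + f′ x) xs ≈ ∑ f xs + ∑ f′ xs
  ∑-+ f f′ []       = ≈-sym (+-identityʳ 0#)
  ∑-+ f f′ (x ∷ xs) = ≈-trans (+-congˡ (∑-+ f f′ xs)) (+-interchange _ _ _ _)

  ∑-neg : ∀ (f : A → Carrier) xs → ∑ (λ x → - f x) xs ≈ - ∑ f xs
  ∑-neg f []       = ≈-sym ε⁻¹≈ε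
  ∑-neg f (x ∷ xs) = ≈-trans (+-congˡ (∑-neg f xs)) (⁻¹-∙-comm _ _)

  ∑-*ˡ : ∀ k (f : A → Carrier) xs → ∑ (λ x → k * f x) xs ≈ k * ∑ f xs
  ∑-*ˡ k f []       = ≈-sym (zeroʳ k)
  ∑-*ˡ k f (x ∷ xs) = ≈-trans (+-congˡ (∑-*ˡ k f xs)) (≈-sym (distribˡ k _ _))

  ∑-*ʳ : ∀ k (f : A → Carrier) xs → ∑ (λ x → f x * k) xs ≈ ∑ f xs * k
  ∑-*ʳ k f []       = ≈-sym (zeroˡ k)
  ∑-*ʳ k f (x ∷ xs) = ≈-trans (+-congˡ (∑-*ʳ k f xs)) (≈-sym (distribʳ k _ _))

  ∑-swap : ∀ (f : A → B → Carrier) xs ys → ∑ (λ x → ∑ (f x) ys) xs ≈ ∑ (λ y → ∑ (λ x → f x y) xs) ys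
  ∑-swap f []       ys = ≈-sym (∑-vanish (All.universal (λ _ → ≈-refl) ys))
  ∑-swap f (x ∷ xs) ys = ≈-trans (+-congˡ (∑-swap f xs ys)) (≈-sym (∑-+ (f x) _ ys))

  ∑∑-* : ∀ (f : A → Carrier) (f′ : B → Carrier) xs ys →
         ∑ (λ x → ∑ (λ y → f x * f′ y) ys) xs ≈ ∑ f xs * ∑ f′ ys
  ∑∑-* f f′ xs ys = ≈-trans (∑-cong (λ x → ∑-*ˡ (f x) f′ ys) xs) (∑-*ʳ (∑ f′ ys) f xs)

  fromℕ : ℕ → Carrier
  fromℕ = natToK R

  fromℕ-+ : ∀ m n → fromℕ (m ℕ.+ n) ≈ fromℕ m + fromℕ n
  fromℕ-+ zero    n = ≈-sym (+-identityˡ _)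
  fromℕ-+ (suc m) n = ≈-trans (+-congˡ (fromℕ-+ m n)) (≈-sym (+-assoc _ _ _))

  ∑-fromℕ : ∀ (f : A → ℕ) xs → ∑ (λ x → fromℕ (f x)) xs ≈ fromℕ (sum (map f xs))
  ∑-fromℕ f []       = ≈-refl
  ∑-fromℕ f (x ∷ xs) = ≈-trans (+-congˡ (∑-fromℕ f xs)) (≈-sym (fromℕ-+ (f x) _))

module SignFunctional {c ℓ} (K : CharZeroField c ℓ) where
  open CharZeroField K renaming (refl to ≈-refl; sym to ≈-sym; trans to ≈-trans; reflexive to ≈-reflexive)
  open Operad K
  open ListSums commutativeRing
  open import Algebra.Properties.AbelianGroup +-abelianGroup using (⁻¹-anti-homo‿-; ε⁻¹≈ε)
  open import Algebra.Properties.Ring ring using (-‿distribʳ-*)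
  open import Relation.Binary.Reasoning.Setoid setoid

  ⟦_⟧ : Bool → Carrier
  ⟦ true  ⟧ = 1#
  ⟦ false ⟧ = 0#

  fromℕ-#≅ : ∀ (h : MG n) L → fromℕ (#≅ h L) ≈ ∑ (λ r → ⟦ does (h ≅MG? r) ⟧) L
  fromℕ-#≅ h []      = ≈-refl
  fromℕ-#≅ h (r ∷ L) with does (h ≅MG? r)
  ... | true  = +-congˡ (fromℕ-#≅ h L)
  ... | false = ≈-trans (fromℕ-#≅ h L) (≈-sym (+-identityˡ _))

  lin : (MG n → Carrier) → FS n → Carrier
  lin w = ∑ (λ (a , g) → a * w g)

  lin-cong : ∀ {w w′ : MG n → Carrier} → (∀ g → w g ≈ w′ g) → ∀ x → lin w x ≈ lin w′ x
  lin-cong w≈w′ = ∑-cong (λ (a , g) → *-congˡ (w≈w′ g))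

  lin-vanish : ∀ {w : MG n → Carrier} → (∀ g → w g ≈ 0#) → ∀ x → lin w x ≈ 0#
  lin-vanish w≈0 x = ∑-vanish (All.universal (λ (a , g) → ≈-trans (*-congˡ (w≈0 g)) (zeroʳ a)) x)

  lin-++ : ∀ (w : MG n → Carrier) x y → lin w (x ++ y) ≈ lin w x + lin w y
  lin-++ w = ∑-++ (λ (a , g) → a * w g)

  lin-+ : ∀ (w w′ : MG n → Carrier) x → lin (λ g → w g + w′ g) x ≈ lin w x + lin w′ x
  lin-+ w w′ x = ≈-trans (∑-cong (λ (a , g) → distribˡ a (w g) (w′ g)) x) (∑-+ _ _ x)

  lin-neg : ∀ (w : MG n → Carrier) x → lin (λ g → - w g) x ≈ - lin w x
  lin-neg w x = ≈-trans (∑-cong (λ (a , g) → ≈-sym (-‿distribʳ-* a (w g))) x) (∑-neg _ x)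

  lin-scale : ∀ (w : MG n → Carrier) a x → lin w (scaleFS a x) ≈ a * lin w x
  lin-scale w a x = begin
    lin w (scaleFS a x)           ≡⟨ ∑-map _ _ x ⟩
    ∑ (λ (b , g) → (a * b) * w g) x ≈⟨ ∑-cong (λ (b , g) → *-assoc a b (w g)) x ⟩
    ∑ (λ (b , g) → a * (b * w g)) x ≈⟨ ∑-*ˡ a _ x ⟩
    a * lin w x                   ∎

  lin-relabel : ∀ (w : MG n → Carrier) (σ : Permutation′ n) x →
                  lin w (relabelFS σ x) ≡ lin (λ g → w (relabelMG (σ ⟨$⟩ʳ_) g)) x
  lin-relabel w σ x = ∑-map _ _ x

  coeff≈lin : ∀ (x : FS n) g → coeff x g ≈ lin (λ h → ⟦ does (h ≅MG? g) ⟧) x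
  coeff≈lin []            g = ≈-refl
  coeff≈lin ((a , h) ∷ x) g with does (h ≅MG? g)
  ... | true  = +-cong (≈-sym (*-identityʳ a)) (coeff≈lin x g)
  ... | false = ≈-trans (coeff≈lin x g) (≈-sym (≈-trans (+-congʳ (zeroʳ a)) (+-identityˡ _)))

  lin-#≅ : ∀ (L : List (MG n)) x → lin (λ h → fromℕ (#≅ h L)) x ≈ ∑ (coeff x) L
  lin-#≅ L x = begin
    lin (λ h → fromℕ (#≅ h L)) x                          ≈⟨ lin-cong (λ h → fromℕ-#≅ h L) x ⟩
    ∑ (λ (a , h) → a * ∑ (λ r → ⟦ does (h ≅MG? r) ⟧) L) x ≈⟨ ∑-cong (λ (a , h) → ∑-*ˡ a _ L) x ⟨
    ∑ (λ (a , h) → ∑ (λ r → a * ⟦ does (h ≅MG? r) ⟧) L) x ≈⟨ ∑-swap _ x L ⟩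
    ∑ (λ r → lin (λ h → ⟦ does (h ≅MG? r) ⟧) x) L         ≈⟨ ∑-cong (coeff≈lin x) L ⟨
    ∑ (coeff x) L                                        ∎

  φ : MG n → Carrier
  φ {n} g = fromℕ (#≅ g (evenPathsOf n)) + - fromℕ (#≅ g (oddPathsOf n))

  Φ : FS n → Carrier
  Φ = lin φ

  Φ≈coeffs : ∀ (x : FS n) → Φ x ≈ ∑ (coeff x) (evenPathsOf n) + - ∑ (coeff x) (oddPathsOf n)
  Φ≈coeffs {n} x = begin
    Φ x
      ≈⟨ lin-+ _ _ x ⟩
    lin (λ g → fromℕ (#≅ g (evenPathsOf n))) x + lin (λ g → - fromℕ (#≅ g (oddPathsOf n))) x
      ≈⟨ +-congˡ (lin-neg _ x) ⟩
    lin (λ g → fromℕ (#≅ g (evenPathsOf n))) x + - lin (λ g → fromℕ (#≅ g (oddPathsOf n))) x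
      ≈⟨ +-cong (lin-#≅ (evenPathsOf n) x) (-‿cong (lin-#≅ (oddPathsOf n) x)) ⟩
    ∑ (coeff x) (evenPathsOf n) + - ∑ (coeff x) (oddPathsOf n) ∎

  Φ-resp : ∀ {x y : FS n} → x ≈FS y → Φ x ≈ Φ y
  Φ-resp {n} {x} {y} x≈y = begin
    Φ x                                                        ≈⟨ Φ≈coeffs x ⟩
    ∑ (coeff x) (evenPathsOf n) + - ∑ (coeff x) (oddPathsOf n)
      ≈⟨ +-cong (∑-cong x≈y (evenPathsOf n)) (-‿cong (∑-cong x≈y (oddPathsOf n))) ⟩
    ∑ (coeff y) (evenPathsOf n) + - ∑ (coeff y) (oddPathsOf n) ≈⟨ Φ≈coeffs y ⟨
    Φ y                                                        ∎

  φ-offArity3 : n ≢ 3 → ∀ (g : MG n) → φ g ≈ 0#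
  φ-offArity3 {0}                         _   _ = -‿inverseʳ 0#
  φ-offArity3 {1}                         _   _ = -‿inverseʳ 0#
  φ-offArity3 {2}                         _   _ = -‿inverseʳ 0#
  φ-offArity3 {3}                         n≢3 _ = ⊥-elim (n≢3 refl)
  φ-offArity3 {suc (suc (suc (suc _)))}   _   _ = -‿inverseʳ 0#

  φ-offPaths : ∀ (f : MG 3 → ℕ) → (∀ {g h} → g ≅MG h → f g ≡ f h) → ∀ v →
               All (λ p → f p ≡ v) (evenPaths ++ oddPaths) → ∀ g → f g ≢ v → φ g ≈ 0#
  φ-offPaths f f-invariant v f-paths g fg≢v = begin
    φ g       ≈⟨ +-cong (≈-reflexive (cong fromℕ (#≅-absent {g = g} g∉evens)))
                        (-‿cong (≈-reflexive (cong fromℕ (#≅-absent {g = g} g∉odds)))) ⟩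
    0# + - 0# ≈⟨ -‿inverseʳ 0# ⟩
    0#        ∎
    where
    g∉paths : All (λ p → ¬ g ≅MG p) (evenPaths ++ oddPaths)
    g∉paths = All.map (λ fp≡v g≅p → fg≢v (trans (f-invariant g≅p) fp≡v)) f-paths
    g∉evens : All (λ p → ¬ g ≅MG p) evenPaths
    g∉evens = proj₁ (++⁻ evenPaths g∉paths)
    g∉odds : All (λ p → ¬ g ≅MG p) oddPaths
    g∉odds = proj₂ (++⁻ evenPaths g∉paths)

  φ-length : ∀ (g : MG 3) → length g ≢ 3 → φ g ≈ 0#
  φ-length = φ-offPaths length (λ {g} {h} → ≅-length {g} {h}) 3 (refl ∷ refl ∷ refl ∷ refl ∷ refl ∷ refl ∷ [])

  φ-loopAt2 : ∀ (g : MG 3) → count 2F 2F g ≢ 0 → φ g ≈ 0#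
  φ-loopAt2 = φ-offPaths (count 2F 2F) (λ g≅h → g≅h 2F 2F) 0 (refl ∷ refl ∷ refl ∷ refl ∷ refl ∷ refl ∷ [])

  ∑φ-balanced : ∀ (L : List (MG 3)) → Balanced L → ∑ φ L ≈ 0#
  ∑φ-balanced L balanced = begin
    ∑ φ L
      ≈⟨ ∑-+ _ _ L ⟩
    ∑ (λ r → fromℕ (#≅ r evenPaths)) L + ∑ (λ r → - fromℕ (#≅ r oddPaths)) L
      ≈⟨ +-cong (∑-fromℕ _ L) (∑-neg _ L) ⟩
    fromℕ (sum (map (λ r → #≅ r evenPaths) L)) + - ∑ (λ r → fromℕ (#≅ r oddPaths)) L
      ≈⟨ +-cong (≈-reflexive (cong fromℕ balanced)) (-‿cong (∑-fromℕ _ L)) ⟩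
    fromℕ (sum (map (λ r → #≅ r oddPaths) L)) + - fromℕ (sum (map (λ r → #≅ r oddPaths) L))
      ≈⟨ -‿inverseʳ _ ⟩
    0# ∎

  #≅-transpose : ∀ (i j : Fin 3) g {L L′} → map (relabelMG (transpose i j ⟨$⟩ˡ_)) L ≋ L′ →
                 #≅ (relabelMG (transpose i j ⟨$⟩ʳ_) g) L ≡ #≅ g L′
  #≅-transpose i j g {L} τL≋L′ = trans (#≅-relabel (transpose i j) g L) (τL≋L′ g)

  φ-transpose : ∀ (i j : Fin 3) →
                (∀ g → φ (relabelMG (transpose i j ⟨$⟩ʳ_) g) ≈ φ g) ⊎
                (∀ g → φ (relabelMG (transpose i j ⟨$⟩ʳ_) g) ≈ - φ g)
  φ-transpose i j = Sum.map preserves swaps (transpose-parity i j)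
    where
    preserves : PreservesParity (transpose i j ⟨$⟩ˡ_) → ∀ g → φ (relabelMG (transpose i j ⟨$⟩ʳ_) g) ≈ φ g
    preserves (evens , odds) g = ≈-reflexive (cong₂ (λ p q → fromℕ p + - fromℕ q)
      (#≅-transpose i j g {evenPaths} {evenPaths} evens) (#≅-transpose i j g {oddPaths} {oddPaths} odds))
    swaps : SwapsParity (transpose i j ⟨$⟩ˡ_) → ∀ g → φ (relabelMG (transpose i j ⟨$⟩ʳ_) g) ≈ - φ g
    swaps (evens , odds) g = ≈-trans (≈-reflexive (cong₂ (λ p q → fromℕ p + - fromℕ q)
      (#≅-transpose i j g {evenPaths} {oddPaths} evens) (#≅-transpose i j g {oddPaths} {evenPaths} odds)))
      (≈-sym (⁻¹-anti-homo‿- _ _))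

  relabelFS-cong : ∀ {σ ρ : Permutation′ n} → (∀ i → σ ⟨$⟩ʳ i ≡ ρ ⟨$⟩ʳ i) →
                   ∀ x → relabelFS σ x ≡ relabelFS ρ x
  relabelFS-cong σ≗ρ = map-cong (λ (a , g) → cong (a ,_) (map-cong (λ (x , y) → cong₂ _,_ (σ≗ρ x) (σ≗ρ y)) g))

  relabelFS-∘ : ∀ (σ ρ : Permutation′ n) x → relabelFS (σ ∘ₚ ρ) x ≡ relabelFS ρ (relabelFS σ x)
  relabelFS-∘ σ ρ x = trans (map-cong (λ (a , g) → cong (a ,_) (map-∘ g)) x) (map-∘ x)

  relabelFS-id : ∀ (x : FS n) → relabelFS id x ≡ x
  relabelFS-id x = trans (map-cong (λ (a , g) → cong (a ,_) (trans (map-cong (λ _ → refl) g) (map-id g))) x)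
                         (map-id x)

  ker-transpose : ∀ (i j : Fin 3) x → Φ x ≈ 0# → Φ (relabelFS (transpose i j) x) ≈ 0#
  ker-transpose i j x Φx≈0 = Sum.[ preserved , negated ]′ (φ-transpose i j)
    where
    φτ : MG 3 → Carrier
    φτ g = φ (relabelMG (transpose i j ⟨$⟩ʳ_) g)
    preserved : (∀ g → φτ g ≈ φ g) → Φ (relabelFS (transpose i j) x) ≈ 0#
    preserved φτ≈φ = begin
      Φ (relabelFS (transpose i j) x) ≡⟨ lin-relabel φ (transpose i j) x ⟩
      lin φτ x                        ≈⟨ lin-cong φτ≈φ x ⟩
      Φ x                             ≈⟨ Φx≈0 ⟩
      0#                              ∎
    negated : (∀ g → φτ g ≈ - φ g) → Φ (relabelFS (transpose i j) x) ≈ 0#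
    negated φτ≈-φ = begin
      Φ (relabelFS (transpose i j) x) ≡⟨ lin-relabel φ (transpose i j) x ⟩
      lin φτ x                        ≈⟨ lin-cong φτ≈-φ x ⟩
      lin (λ g → - φ g) x             ≈⟨ lin-neg φ x ⟩
      - Φ x                           ≈⟨ -‿cong Φx≈0 ⟩
      - 0#                            ≈⟨ ε⁻¹≈ε ⟩
      0#                              ∎

  ker-eval : ∀ (ts : TranspositionList 3) x → Φ x ≈ 0# → Φ (relabelFS (eval ts) x) ≈ 0#
  ker-eval []             x Φx≈0 = ≈-trans (≈-reflexive (cong Φ (relabelFS-id x))) Φx≈0
  ker-eval ((i , j) ∷ ts) x Φx≈0 =
    ≈-trans (≈-reflexive (cong Φ (relabelFS-∘ (transpose i j) (eval ts) x)))
            (ker-eval ts (relabelFS (transpose i j) x) (ker-transpose i j x Φx≈0))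

  ker-relabel : ∀ (σ : Permutation′ n) x → Φ x ≈ 0# → Φ (relabelFS σ x) ≈ 0#
  ker-relabel {n} σ x Φx≈0 with n ℕ.≟ 3
  ... | yes refl = ≈-trans (≈-reflexive (cong Φ (relabelFS-cong {σ = σ} {eval (decompose σ)} σ≗eval x)))
                           (ker-eval (decompose σ) x Φx≈0)
    where
    σ≗eval : ∀ i → σ ⟨$⟩ʳ i ≡ eval (decompose σ) ⟨$⟩ʳ i
    σ≗eval i = sym (eval-decompose σ i)
  ... | no n≢3 = lin-vanish (φ-offArity3 n≢3) (relabelFS σ x)

  lin-comp : ∀ {m k} (w : MG (m ℕ.+ k) → Carrier) (x : FS (suc m)) (y : FS k) →
             lin w (compFS x y) ≈ ∑ (λ (a , g) → ∑ (λ (b , h) → (a * b) * ∑ w (insertMG g h)) y) x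
  lin-comp w x y = ≈-trans (∑-concatMap _ _ x) (∑-cong (λ (a , g) → termwise a g) x)
    where
    termwise : ∀ a g → lin w (concatMap (λ (b , h) → map (λ r → (a * b , r)) (insertMG g h)) y) ≈
                       ∑ (λ (b , h) → (a * b) * ∑ w (insertMG g h)) y
    termwise a g = ≈-trans (∑-concatMap _ _ y) (∑-cong (λ (b , h) → term b h) y)
      where
      term : ∀ b h → lin w (map (λ r → (a * b , r)) (insertMG g h)) ≈ (a * b) * ∑ w (insertMG g h)
      term b h = ≈-trans (≈-reflexive (∑-map _ _ (insertMG g h))) (∑-*ˡ (a * b) w (insertMG g h))

  lin-comp-factor : ∀ {m k} (w : MG (m ℕ.+ k) → Carrier)
                    (F : Carrier × MG (suc m) → Carrier) (G : Carrier × MG k → Carrier) →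
                    (∀ a b g h → (a * b) * ∑ w (insertMG g h) ≈ F (a , g) * G (b , h)) →
                    ∀ x y → lin w (compFS x y) ≈ ∑ F x * ∑ G y
  lin-comp-factor w F G factors x y = begin
    lin w (compFS x y)
      ≈⟨ lin-comp w x y ⟩
    ∑ (λ (a , g) → ∑ (λ (b , h) → (a * b) * ∑ w (insertMG g h)) y) x
      ≈⟨ ∑-cong (λ (a , g) → ∑-cong (λ (b , h) → factors a b g h) y) x ⟩
    ∑ (λ p → ∑ (λ q → F p * G q) y) x
      ≈⟨ ∑∑-* F G x y ⟩
    ∑ F x * ∑ G y ∎

  emptyCoeff : Carrier × MG n → Carrier
  emptyCoeff (a , [])    = a
  emptyCoeff (a , _ ∷ _) = 0#

  ∑φ-loopEnds : ∀ (L : MG 3) → ∑ (λ e → φ (e ∷ L)) (edgeChoices {0} {3} (0F , 0F)) ≈ 0#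
  ∑φ-loopEnds L = byLength (length L ℕ.≟ 2)
    where
    E : List (Edge 3)
    E = edgeChoices {0} {3} (0F , 0F)
    byLength : Dec (length L ≡ 2) → ∑ (λ e → φ (e ∷ L)) E ≈ 0#
    byLength (yes len≡2) =
      ≈-trans (≈-reflexive (sym (∑-map φ (_∷ L) E))) (∑φ-balanced (map (_∷ L) E) (loop-balanced L len≡2))
    byLength (no  len≢2) = ∑-vanish (All.universal (λ e → φ-length (e ∷ L) (len≢2 ∘ ℕ.suc-injective)) E)

  ∑φ-insert-1∘3 : ∀ a b (g : MG 1) (h : MG 3) →
                  (a * b) * ∑ φ (insertMG {0} {3} g h) ≈ emptyCoeff (a , g) * (b * φ h)
  ∑φ-insert-1∘3 a b [] h = begin
    (a * b) * (φ (relabelMG (0 ↑ʳ_) h) + 0#)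
      ≈⟨ *-congˡ (+-identityʳ _) ⟩
    (a * b) * φ (relabelMG (0 ↑ʳ_) h)
      ≡⟨ cong (λ h′ → (a * b) * φ h′) (trans (map-cong (λ _ → refl) h) (map-id h)) ⟩
    (a * b) * φ h
      ≈⟨ *-assoc a b (φ h) ⟩
    a * (b * φ h) ∎
  ∑φ-insert-1∘3 a b ((0F , 0F) ∷ es) h = begin
    (a * b) * ∑ φ (map (_++ H) (concatMap (λ e → map (e ∷_) A) E))
      ≡⟨ cong ((a * b) *_) (∑-map φ (_++ H) (concatMap (λ e → map (e ∷_) A) E)) ⟩
    (a * b) * ∑ (λ r → φ (r ++ H)) (concatMap (λ e → map (e ∷_) A) E)
      ≈⟨ *-congˡ (∑-concatMap (λ r → φ (r ++ H)) (λ e → map (e ∷_) A) E) ⟩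
    (a * b) * ∑ (λ e → ∑ (λ r → φ (r ++ H)) (map (e ∷_) A)) E
      ≈⟨ *-congˡ (∑-cong (λ e → ≈-reflexive (∑-map (λ r → φ (r ++ H)) (e ∷_) A)) E) ⟩
    (a * b) * ∑ (λ e → ∑ (λ r → φ (e ∷ (r ++ H))) A) E
      ≈⟨ *-congˡ (∑-swap (λ e r → φ (e ∷ (r ++ H))) E A) ⟩
    (a * b) * ∑ (λ r → ∑ (λ e → φ (e ∷ (r ++ H))) E) A
      ≈⟨ *-congˡ (∑-vanish (All.universal (λ r → ∑φ-loopEnds (r ++ H)) A)) ⟩
    (a * b) * 0#   ≈⟨ zeroʳ _ ⟩
    0#             ≈⟨ zeroˡ _ ⟨
    0# * (b * φ h) ∎
    where
    H : MG 3
    H = relabelMG (0 ↑ʳ_) h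
    A : List (MG 3)
    A = allChoices {0} {3} es
    E : List (Edge 3)
    E = edgeChoices {0} {3} (0F , 0F)

  ∑φ-insert-2∘2 : ∀ (g h : MG 2) → ∑ φ (insertMG {1} {2} g h) ≈ 0#
  ∑φ-insert-2∘2 g h = byLength (length g ℕ.+ length h ℕ.≟ 3)
    where
    byLength : Dec (length g ℕ.+ length h ≡ 3) → ∑ φ (insertMG {1} {2} g h) ≈ 0#
    byLength (yes len≡3) =
      ∑φ-balanced (insertMG g h) (2∘2-balanced (length g) (length h) len≡3 g refl h refl)
    byLength (no  len≢3) = ∑-vanish (All.map (λ {r} len → φ-length r (λ r≡3 → len≢3 (trans (sym len) r≡3)))
                                             (insertMG-length g h))

  ∑φ-insert-3∘1 : ∀ a b (g : MG 3) (h : MG 1) →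
                  (a * b) * ∑ φ (insertMG {2} {1} g h) ≈
                  (a * φ (relabelMG (rotation ⟨$⟩ʳ_) g)) * emptyCoeff (b , h)
  ∑φ-insert-3∘1 a b g h = begin
    (a * b) * ∑ φ (insertMG g h)
      ≡⟨ cong (λ gs → (a * b) * ∑ φ (map (_++ relabelMG (2 ↑ʳ_) h) gs)) (allChoices-rotation g) ⟩
    (a * b) * (φ (R ++ relabelMG (2 ↑ʳ_) h) + 0#)
      ≈⟨ byLoops h ⟩
    (a * φ R) * emptyCoeff (b , h) ∎
    where
    R : MG 3
    R = relabelMG (rotation ⟨$⟩ʳ_) g
    byLoops : ∀ h → (a * b) * (φ (R ++ relabelMG (2 ↑ʳ_) h) + 0#) ≈ (a * φ R) * emptyCoeff (b , h)
    byLoops [] = begin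
      (a * b) * (φ (R ++ []) + 0#) ≈⟨ *-congˡ (+-identityʳ _) ⟩
      (a * b) * φ (R ++ [])        ≡⟨ cong (λ r → (a * b) * φ r) (++-identityʳ R) ⟩
      (a * b) * φ R                ≈⟨ *-assoc a b (φ R) ⟩
      a * (b * φ R)                ≈⟨ *-congˡ (*-comm b (φ R)) ⟩
      a * (φ R * b)                ≈⟨ *-assoc a (φ R) b ⟨
      (a * φ R) * b                ∎
    byLoops ((0F , 0F) ∷ hs) = begin
      (a * b) * (φ (R ++ H) + 0#) ≈⟨ *-congˡ (≈-trans (+-identityʳ _) (φ-loopAt2 (R ++ H) hasLoop)) ⟩
      (a * b) * 0#                ≈⟨ zeroʳ _ ⟩
      0#                          ≈⟨ zeroʳ _ ⟨
      (a * φ R) * 0#              ∎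
      where
      H : MG 3
      H = relabelMG (2 ↑ʳ_) ((0F , 0F) ∷ hs)
      hasLoop : count 2F 2F (R ++ H) ≢ 0
      hasLoop c≡0 = ℕ.1+n≢0 (trans (sym (ℕ.+-suc _ _)) (trans (sym (count-++ 2F 2F R H)) c≡0))

  ker-comp : ∀ {m k} → CompArity m k → (x : FS (suc m)) (y : FS (suc k)) →
             Φ x ≈ 0# → Φ y ≈ 0# → Φ (compFS x y) ≈ 0#
  ker-comp 1∘3 x y _ Φy≈0 = begin
    Φ (compFS x y)       ≈⟨ lin-comp-factor φ emptyCoeff (λ (b , h) → b * φ h) ∑φ-insert-1∘3 x y ⟩
    ∑ emptyCoeff x * Φ y ≈⟨ *-congˡ Φy≈0 ⟩
    ∑ emptyCoeff x * 0#  ≈⟨ zeroʳ _ ⟩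
    0#                   ∎
  ker-comp 2∘2 x y _ _ =
    ≈-trans (lin-comp φ x y)
            (∑-vanish (All.universal (λ (a , g) →
              ∑-vanish (All.universal (λ (b , h) → ≈-trans (*-congˡ (∑φ-insert-2∘2 g h)) (zeroʳ _)) y)) x))
  ker-comp 3∘1 x y Φx≈0 _ = begin
    Φ (compFS x y)                            ≈⟨ lin-comp-factor φ φρ emptyCoeff ∑φ-insert-3∘1 x y ⟩
    ∑ φρ x * ∑ emptyCoeff y                   ≡⟨ cong (_* ∑ emptyCoeff y) (lin-relabel φ rotation x) ⟨
    Φ (relabelFS rotation x) * ∑ emptyCoeff y ≈⟨ *-congʳ (ker-relabel rotation x Φx≈0) ⟩
    0# * ∑ emptyCoeff y                       ≈⟨ zeroˡ _ ⟩
    0#                                        ∎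
    where
    φρ : Carrier × MG 3 → Carrier
    φρ (a , g) = a * φ (relabelMG (rotation ⟨$⟩ʳ_) g)
  ker-comp (other ar≢3) x y _ _ = lin-vanish (φ-offArity3 ar≢3) (compFS x y)

  LP⊆kerΦ : ∀ {n} {x : FS n} → LP x → Φ x ≈ 0#
  LP⊆kerΦ {x = x} (gen loop)         = lin-vanish (φ-offArity3 (λ ())) x
  LP⊆kerΦ {x = x} (gen edgeless)     = lin-vanish (φ-offArity3 (λ ())) x
  LP⊆kerΦ {x = x} unit               = lin-vanish (φ-offArity3 (λ ())) x
  LP⊆kerΦ zeroEl                     = ≈-refl
  LP⊆kerΦ (add {x = x} {y} p q)      =
    ≈-trans (lin-++ φ x y) (≈-trans (+-cong (LP⊆kerΦ p) (LP⊆kerΦ q)) (+-identityʳ 0#))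
  LP⊆kerΦ (scale a {x} p)            = ≈-trans (lin-scale φ a x) (≈-trans (*-congˡ (LP⊆kerΦ p)) (zeroʳ a))
  LP⊆kerΦ (relabel σ {x} p)          = ker-relabel σ x (LP⊆kerΦ p)
  LP⊆kerΦ (comp {m} {k} {x} {y} p q) = ker-comp (compArity m k) x y (LP⊆kerΦ p) (LP⊆kerΦ q)
  LP⊆kerΦ (resp {x = x} {y} x≈y p)   = ≈-trans (≈-sym (Φ-resp {x = x} {y} x≈y)) (LP⊆kerΦ p)

  Φ-gABBCBC : Φ (basis gABBCBC) ≈ 1#
  Φ-gABBCBC = begin
    1# * ((1# + 0#) + - 0#) + 0# ≈⟨ +-identityʳ _ ⟩
    1# * ((1# + 0#) + - 0#)      ≈⟨ *-identityˡ _ ⟩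
    (1# + 0#) + - 0#             ≈⟨ +-cong (+-identityʳ 1#) ε⁻¹≈ε ⟩
    1# + 0#                      ≈⟨ +-identityʳ 1# ⟩
    1#                           ∎

  gABBCBC∉LP : ¬ LP (basis gABBCBC)
  gABBCBC∉LP p = 1≉0 (≈-trans (≈-sym Φ-gABBCBC) (LP⊆kerΦ p))

module SPinLP {c ℓ} (K : CharZeroField c ℓ) where
  open CharZeroField K renaming (refl to ≈-refl; sym to ≈-sym; trans to ≈-trans; reflexive to ≈-reflexive)
  open Operad K
  open ListSums commutativeRing
  open SignFunctional K using (⟦_⟧; lin; lin-++; lin-scale; coeff≈lin)
  open import Algebra.Properties.Ring ring using (-1*x≈-x)
  open import Relation.Binary.Reasoning.Setoid setoid

  Generated-mono : ∀ {G₁ G₂ : ∀ {n} → FS n → Set c} → (∀ {n} {x : FS n} → G₁ x → Generated G₂ x) →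
                   ∀ {n} {x : FS n} → Generated G₁ x → Generated G₂ x
  Generated-mono G₁⊆G₂ (gen g)       = G₁⊆G₂ g
  Generated-mono G₁⊆G₂ unit          = unit
  Generated-mono G₁⊆G₂ zeroEl        = zeroEl
  Generated-mono G₁⊆G₂ (add p q)     = add (Generated-mono G₁⊆G₂ p) (Generated-mono G₁⊆G₂ q)
  Generated-mono G₁⊆G₂ (scale a p)   = scale a (Generated-mono G₁⊆G₂ p)
  Generated-mono G₁⊆G₂ (relabel σ p) = relabel σ (Generated-mono G₁⊆G₂ p)
  Generated-mono G₁⊆G₂ (comp p q)    = comp (Generated-mono G₁⊆G₂ p) (Generated-mono G₁⊆G₂ q)
  Generated-mono G₁⊆G₂ (resp e p)    = resp e (Generated-mono G₁⊆G₂ p)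

  two : Carrier
  two = fromℕ 2

  two≉0 : ¬ two ≈ 0#
  two≉0 two≈0 with charZero 2 two≈0
  ... | ()

  ½ : Carrier
  ½ = proj₁ (inverse two two≉0)

  ½+½≈1 : ½ + ½ ≈ 1#
  ½+½≈1 = begin
    ½ + ½                  ≈⟨ +-cong (*-identityˡ ½) (≈-trans (*-congʳ (+-identityʳ 1#)) (*-identityˡ ½)) ⟨
    1# * ½ + (1# + 0#) * ½ ≈⟨ distribʳ ½ 1# (1# + 0#) ⟨
    two * ½                ≈⟨ proj₂ (inverse two two≉0) ⟩
    1#                     ∎

  cancel-outer : ∀ a x b → (a + (x + b)) + - (a + b) ≈ x
  cancel-outer a x b = begin
    (a + (x + b)) + - (a + b) ≈⟨ +-congʳ (+-congˡ (+-comm x b)) ⟩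
    (a + (b + x)) + - (a + b) ≈⟨ +-congʳ (+-assoc a b x) ⟨
    ((a + b) + x) + - (a + b) ≈⟨ +-congʳ (+-comm (a + b) x) ⟩
    (x + (a + b)) + - (a + b) ≈⟨ +-assoc x (a + b) _ ⟩
    x + ((a + b) + - (a + b)) ≈⟨ +-congˡ (-‿inverseʳ (a + b)) ⟩
    x + 0#                    ≈⟨ +-identityʳ x ⟩
    x                         ∎

  lin-units : ∀ {n} (w : MG n → Carrier) gs → lin w (map (1# * 1# ,_) gs) ≈ ∑ w gs
  lin-units w gs =
    ≈-trans (≈-reflexive (∑-map _ _ gs))
            (∑-cong (λ g → ≈-trans (*-congʳ (*-identityˡ 1#)) (*-identityˡ (w g))) gs)

  loopFS : FS 1
  loopFS = basis ((0F , 0F) ∷ [])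

  edgelessFS : FS 2
  edgelessFS = basis []

  singleEdge : MG 2
  singleEdge = (0F , 1F) ∷ []

  loopAt1 : FS 2
  loopAt1 = compFS {1} {1} edgelessFS loopFS

  allEdges : FS 2
  allEdges = compFS {0} {2} loopFS edgelessFS

  edgeCombination : FS 2
  edgeCombination = scaleFS ½ (allEdges ++ scaleFS (- 1#) (relabelFS (transpose 0F 1F) loopAt1 ++ loopAt1))

  edgeCombination∈LP : LP edgeCombination
  edgeCombination∈LP =
    scale ½ (add (comp (gen loop) (gen edgeless))
                 (scale (- 1#) (add (relabel (transpose 0F 1F) loopAt1∈LP) loopAt1∈LP)))
    where
    loopAt1∈LP : LP loopAt1
    loopAt1∈LP = comp (gen edgeless) (gen loop)

  edgeCombination≈singleEdge : edgeCombination ≈FS basis singleEdge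
  edgeCombination≈singleEdge g = begin
    coeff edgeCombination g                                    ≈⟨ coeff≈lin edgeCombination g ⟩
    lin ι edgeCombination                                      ≈⟨ lin-scale ι ½ (allEdges ++ loops) ⟩
    ½ * lin ι (allEdges ++ loops)                              ≈⟨ *-congˡ (lin-++ ι allEdges loops) ⟩
    ½ * (lin ι allEdges + lin ι loops)                         ≈⟨ *-congˡ (+-cong lin-allEdges lin-loops) ⟩
    ½ * ((ι₀₀ + ((ι₀₁ + ι₀₁) + ι₁₁)) + - (ι₀₀ + ι₁₁))          ≈⟨ *-congˡ (cancel-outer ι₀₀ (ι₀₁ + ι₀₁) ι₁₁) ⟩
    ½ * (ι₀₁ + ι₀₁)                                            ≈⟨ distribˡ ½ ι₀₁ ι₀₁ ⟩
    ½ * ι₀₁ + ½ * ι₀₁                                          ≈⟨ distribʳ ι₀₁ ½ ½ ⟨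
    (½ + ½) * ι₀₁                                              ≈⟨ *-congʳ ½+½≈1 ⟩
    1# * ι₀₁                                                   ≈⟨ +-identityʳ _ ⟨
    lin ι (basis singleEdge)                                   ≈⟨ coeff≈lin (basis singleEdge) g ⟨
    coeff (basis singleEdge) g                                 ∎
    where
    ι : MG 2 → Carrier
    ι h = ⟦ does (h ≅MG? g) ⟧
    ι₀₀ ι₀₁ ι₁₁ : Carrier
    ι₀₀ = ι ((0F , 0F) ∷ [])
    ι₀₁ = ι ((0F , 1F) ∷ [])
    ι₁₁ = ι ((1F , 1F) ∷ [])
    loops : FS 2
    loops = scaleFS (- 1#) (relabelFS (transpose 0F 1F) loopAt1 ++ loopAt1)
    ι₁₀≡ι₀₁ : ι ((1F , 0F) ∷ []) ≡ ι₀₁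
    ι₁₀≡ι₀₁ = cong ⟦_⟧ (≅MG?-congˡ {g = (1F , 0F) ∷ []} {(0F , 1F) ∷ []} reversed g)
      where
      reversed : ((1F , 0F) ∷ []) ≅MG ((0F , 1F) ∷ [])
      reversed = toWitness {a? = ((1F , 0F) ∷ []) ≅MG? ((0F , 1F) ∷ [])} _
    lin-allEdges : lin ι allEdges ≈ ι₀₀ + ((ι₀₁ + ι₀₁) + ι₁₁)
    lin-allEdges = begin
      lin ι allEdges
        ≈⟨ lin-units ι (((0F , 0F) ∷ []) ∷ ((0F , 1F) ∷ []) ∷ ((1F , 0F) ∷ []) ∷ ((1F , 1F) ∷ []) ∷ []) ⟩
      ι₀₀ + (ι₀₁ + (ι ((1F , 0F) ∷ []) + (ι₁₁ + 0#)))
        ≈⟨ +-congˡ (+-congˡ (+-cong (≈-reflexive ι₁₀≡ι₀₁) (+-identityʳ ι₁₁))) ⟩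
      ι₀₀ + (ι₀₁ + (ι₀₁ + ι₁₁))
        ≈⟨ +-congˡ (+-assoc ι₀₁ ι₀₁ ι₁₁) ⟨
      ι₀₀ + ((ι₀₁ + ι₀₁) + ι₁₁) ∎
    lin-loops : lin ι loops ≈ - (ι₀₀ + ι₁₁)
    lin-loops = begin
      lin ι loops
        ≈⟨ lin-scale ι (- 1#) (relabelFS (transpose 0F 1F) loopAt1 ++ loopAt1) ⟩
      - 1# * lin ι (relabelFS (transpose 0F 1F) loopAt1 ++ loopAt1)
        ≈⟨ -1*x≈-x _ ⟩
      - lin ι (relabelFS (transpose 0F 1F) loopAt1 ++ loopAt1)
        ≈⟨ -‿cong (lin-++ ι (relabelFS (transpose 0F 1F) loopAt1) loopAt1) ⟩
      - (lin ι (relabelFS (transpose 0F 1F) loopAt1) + lin ι loopAt1)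
        ≈⟨ -‿cong (+-cong (lin-units ι (((0F , 0F) ∷ []) ∷ [])) (lin-units ι (((1F , 1F) ∷ []) ∷ []))) ⟩
      - ((ι₀₀ + 0#) + (ι₁₁ + 0#))
        ≈⟨ -‿cong (+-cong (+-identityʳ ι₀₀) (+-identityʳ ι₁₁)) ⟩
      - (ι₀₀ + ι₁₁) ∎

  SP⊆LP : ∀ {n} {x : FS n} → SP x → LP x
  SP⊆LP = Generated-mono λ where
    edgeless → gen edgeless
    edge     → resp edgeCombination≈singleEdge edgeCombination∈LP

mainTheorem12 : ∀ {c ℓ : Level} (K : CharZeroField c ℓ) →
    let open Operad K in
    (∀ (n : ℕ) (x : FS n) → SP x → LP x) × ¬ LP (basis gABBCBC)
mainTheorem12 K = (λ n x → SPinLP.SP⊆LP K) , SignFunctional.gABBCBC∉LP K
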